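{- Let $\mathcal{D}=(P,\mathcal{B})$ be a non-trivial symmetric $(v,k,\lambda)$ design admitting a flag-transitive automorphism group $G$. Then $G$ is $2$-transitive on $P$ if and only if $G$ is flag-transitive on $\mathcal{D}'$, the complement design of $\mathcal{D}$.
   Context: A $2$-$(v,k,\lambda)$ design $\mathcal{D}=(P,\mathcal{B})$ consists of a set $P$ of $v$ points and a collection $\mathcal{B}$ of $b$ blocks (subsets of $P$) such that every block contains $k$ points and every pair of distinct points lies in exactly $\lambda$ blocks; it is symmetric if $b=v$ and non-trivial if $2<k<v-1$. An automorphism is a permutation of $P$ mapping $\mathcal{B}$ to itself. A flag is an incident point-block pair, and $G$ is flag-transitive if it is transitive on flags. The complement $\mathcal{D}'$ of $\mathcal{D}$ has the same point set $P$ and blocks $\{P\setminus B: B\in\mathcal{B}\}$; it is a symmetric $(v,v-k,v-2k+\lambda)$ design, and every automorphism of $\mathcal{D}$ is an automorphism of $\mathcal{D}'$. -}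

module Defs where

open import Data.Nat using (ℕ; suc; _<_)
open import Data.Bool using (Bool; true; false; not; _∧_)
open import Data.Fin using (Fin)
open import Data.Fin.Subset using (Subset; ∣_∣)
open import Data.Vec using (tabulate)
open import Data.Fin.Permutation using (Permutation′; _⟨$⟩ʳ_; _⟨$⟩ˡ_; id; flip; _∘ₚ_)
open import Data.Product using (_×_; Σ; ∃; ∃-syntax)
open import Relation.Binary.PropositionalEquality using (_≡_; _≢_)

-- An incidence structure with v points (Fin v) and b blocks (Fin b):
-- I x B ≡ true  iff point x lies in block B.
Incidence : ℕ → ℕ → Set
Incidence v b = Fin v → Fin b → Bool

block : ∀ {v b} → Incidence v b → Fin b → Subset v
block I B = tabulate (λ x → I x B)

blocksThrough : ∀ {v b} → Incidence v b → Fin v → Fin v → Subset b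
blocksThrough I x y = tabulate (λ B → I x B ∧ I y B)

Is2Design : ∀ {v b} → Incidence v b → (k λ' : ℕ) → Set
Is2Design {v} {b} I k λ' =
  ((B : Fin b) → ∣ block I B ∣ ≡ k) ×
  ((x y : Fin v) → x ≢ y → ∣ blocksThrough I x y ∣ ≡ λ')

-- symmetric (b = v) design; blocks indexed by Fin v
IsSymmetricDesign : (v k λ' : ℕ) → Incidence v v → Set
IsSymmetricDesign v k λ' I = Is2Design I k λ'

NonTrivial : (v k : ℕ) → Set
NonTrivial v k = (2 < k) × (suc k < v)

complement : ∀ {v b} → Incidence v b → Incidence v b
complement I x B = not (I x B)

MapsBlock : ∀ {v b} → Incidence v b → Permutation′ v → Fin b → Fin b → Set
MapsBlock {v} I g B C = (x : Fin v) → I (g ⟨$⟩ʳ x) C ≡ I x B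

IsAutomorphism : ∀ {v b} → Incidence v b → Permutation′ v → Set
IsAutomorphism {v} {b} I g = (B : Fin b) → ∃[ C ] MapsBlock I g B C

IsAutGroup : ∀ {v b} → Incidence v b → (Permutation′ v → Set) → Set
IsAutGroup {v} I G =
  ((g : Permutation′ v) → G g → IsAutomorphism I g) ×
  G id ×
  ((g h : Permutation′ v) → G g → G h → G (g ∘ₚ h)) ×
  ((g : Permutation′ v) → G g → G (flip g))

IsFlag : ∀ {v b} → Incidence v b → Fin v → Fin b → Set
IsFlag I x B = I x B ≡ true

FlagTransitive : ∀ {v b} → Incidence v b → (Permutation′ v → Set) → Set
FlagTransitive {v} {b} I G =
  (x y : Fin v) (B C : Fin b) → IsFlag I x B → IsFlag I y C →
  ∃[ g ] (G g × (g ⟨$⟩ʳ x ≡ y) × MapsBlock I g B C)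

TwoTransitive : ∀ {v} → (Permutation′ v → Set) → Set
TwoTransitive {v} G =
  (x₁ x₂ y₁ y₂ : Fin v) → x₁ ≢ x₂ → y₁ ≢ y₂ →
  ∃[ g ] (G g × (g ⟨$⟩ʳ x₁ ≡ y₁) × (g ⟨$⟩ʳ x₂ ≡ y₂))

module Submission where

-- Both conditions say that the point
-- stabiliser G_x is transitive on something: the points ≠ x, resp. the blocks ∌ x.
--
-- SymmetricDesign derives the Gram
-- identities N Nᵀ = Nᵀ N = nI + λJ (n = k − λ; the dual one by a variance
-- argument) and two counting lemmas: a nonempty point set O ∌ x whose block
-- intersections depend only on whether x ∈ B is P ∖ {x}, and a nonempty set of
-- blocks missing x on which all points y ≠ x have the same degree consists of
-- all blocks missing x.  FlagTransitiveGroup applies them to closures under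
-- chosen elements of G_x, which gives both implications.

open import Defs
open import Data.Nat hiding (NonTrivial)
open import Data.Nat.Properties
open import Data.Nat.Tactic.RingSolver using (solve)
open import Data.List using (_∷_; [])
open import Data.Bool using (Bool; true; false; not; _∧_)
import Data.Bool.Properties as Bool
open import Data.Fin using (Fin; zero; suc)
open import Data.Fin.Properties using (any?; all?; ¬∀⟶∃¬) renaming (_≟_ to _≟ᶠ_)
open import Data.Fin.Subset using (∣_∣)
open import Data.Vec using (tabulate)
open import Data.Fin.Permutation
  using (Permutation′; _⟨$⟩ʳ_; _⟨$⟩ˡ_; id; flip; _∘ₚ_; inverseˡ; inverseʳ; permutation)
open import Data.Product using (Σ; ∃; _×_; _,_; proj₁; proj₂)
open import Data.Sum using (_⊎_; inj₁; inj₂)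
open import Data.Empty using (⊥-elim)
open import Relation.Nullary using (Dec; yes; no; ¬_; does)
open import Relation.Nullary.Decidable using (dec-true; dec-false; _⊎-dec_)
open import Relation.Binary.PropositionalEquality
open import Function.Bundles using (_⇔_; mk⇔)
import Algebra.Properties.Semiring.Sum as SemiringSum

module FinSum where

  open SemiringSum +-*-semiring public
    using (sum; ∑-comm; ∑-permute; *-distribˡ-sum; *-distribʳ-sum)
    renaming (sum-cong-≗ to ∑-cong; ∑-distrib-+ to ∑-+)

  ∑ : ∀ {n} → (Fin n → ℕ) → ℕ
  ∑ = sum

  ∑-*ˡ : ∀ {n} c (f : Fin n → ℕ) → ∑ (λ i → c * f i) ≡ c * ∑ f
  ∑-*ˡ c f = sym (*-distribˡ-sum c f)

  ∑-*ʳ : ∀ {n} c (f : Fin n → ℕ) → ∑ (λ i → f i * c) ≡ ∑ f * c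
  ∑-*ʳ c f = sym (*-distribʳ-sum c f)

  ∑-const : ∀ n c → ∑ {n} (λ _ → c) ≡ n * c
  ∑-const zero    c = refl
  ∑-const (suc n) c = cong (c +_) (∑-const n c)

  ∑-product : ∀ {m p} (f : Fin m → ℕ) (g : Fin p → ℕ) →
    ∑ f * ∑ g ≡ ∑ (λ y → ∑ (λ z → f y * g z))
  ∑-product f g = trans (sym (∑-*ʳ (∑ g) f)) (∑-cong (λ y → sym (∑-*ˡ (f y) g)))

  ∑-rotate : ∀ {a b c} (F : Fin a → Fin b → Fin c → ℕ) →
    ∑ (λ i → ∑ (λ j → ∑ (λ l → F i j l))) ≡ ∑ (λ j → ∑ (λ l → ∑ (λ i → F i j l)))
  ∑-rotate F = trans (∑-comm (λ i j → ∑ (λ l → F i j l))) (∑-cong (λ j → ∑-comm (λ i l → F i j l)))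

  ∑-mono : ∀ {n} {f g : Fin n → ℕ} → (∀ i → f i ≤ g i) → ∑ f ≤ ∑ g
  ∑-mono {zero}  f≤g = z≤n
  ∑-mono {suc n} f≤g = +-mono-≤ (f≤g zero) (∑-mono (λ i → f≤g (suc i)))

  ∑-mono-< : ∀ {n} {f g : Fin n → ℕ} → (∀ i → f i ≤ g i) → (j : Fin n) → f j < g j → ∑ f < ∑ g
  ∑-mono-< {suc n} f≤g zero    lt = +-mono-<-≤ lt (∑-mono (λ i → f≤g (suc i)))
  ∑-mono-< {suc n} f≤g (suc j) lt = +-mono-≤-< (f≤g zero) (∑-mono-< (λ i → f≤g (suc i)) j lt)

  ∑-pos : ∀ {n} (f : Fin n → ℕ) → 0 < ∑ f → ∃ λ i → 0 < f i
  ∑-pos {suc n} f pos with f zero in eq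
  ... | suc _ = zero , subst (0 <_) (sym eq) (s≤s z≤n)
  ... | zero  with ∑-pos (λ i → f (suc i)) pos
  ...   | i , fi>0 = suc i , fi>0

  δ : ∀ {n} → Fin n → Fin n → ℕ
  δ zero    zero    = 1
  δ zero    (suc _) = 0
  δ (suc _) zero    = 0
  δ (suc y) (suc z) = δ y z

  δ-refl : ∀ {n} (y : Fin n) → δ y y ≡ 1
  δ-refl zero    = refl
  δ-refl (suc y) = δ-refl y

  δ-≢ : ∀ {n} {y z : Fin n} → y ≢ z → δ y z ≡ 0
  δ-≢ {y = zero}  {zero}  y≢z = ⊥-elim (y≢z refl)
  δ-≢ {y = zero}  {suc z} y≢z = refl
  δ-≢ {y = suc y} {zero}  y≢z = refl
  δ-≢ {y = suc y} {suc z} y≢z = δ-≢ (λ y≡z → y≢z (cong suc y≡z))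

  ∑-δ : ∀ {n} (f : Fin n → ℕ) (y : Fin n) → ∑ (λ z → δ y z * f z) ≡ f y
  ∑-δ {suc n} f zero = begin
    1 * f zero + ∑ (λ z → 0 * f (suc z)) ≡⟨ cong (1 * f zero +_) (∑-const n 0) ⟩
    1 * f zero + n * 0                   ≡⟨ cong₂ _+_ (*-identityˡ (f zero)) (*-zeroʳ n) ⟩
    f zero + 0                           ≡⟨ +-identityʳ (f zero) ⟩
    f zero                               ∎
    where open ≡-Reasoning
  ∑-δ {suc n} f (suc y) = ∑-δ (λ z → f (suc z)) y

  δ*≤ : ∀ {n} (y z : Fin n) t → δ y z * t ≤ t
  δ*≤ zero    zero    t = ≤-reflexive (+-identityʳ t)
  δ*≤ zero    (suc z) t = z≤n
  δ*≤ (suc y) zero    t = z≤n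
  δ*≤ (suc y) (suc z) t = δ*≤ y z t

  term≤∑ : ∀ {n} (f : Fin n → ℕ) y → f y ≤ ∑ f
  term≤∑ f y = ≤-trans (≤-reflexive (sym (∑-δ f y))) (∑-mono (λ z → δ*≤ y z (f z)))

  ∑-except : ∀ {n} (f : Fin n → ℕ) (c : ℕ) (y : Fin n) → (∀ z → y ≢ z → f z ≡ c) →
    ∑ f + c ≡ f y + n * c
  ∑-except {n} f c y f≡c = begin
    ∑ f + c                                ≡⟨ cong (∑ f +_) (sym (∑-δ (λ _ → c) y)) ⟩
    ∑ f + ∑ (λ z → δ y z * c)              ≡⟨ sym (∑-+ f _) ⟩
    ∑ (λ z → f z + δ y z * c)              ≡⟨ ∑-cong termwise ⟩
    ∑ (λ z → δ y z * f y + c)              ≡⟨ ∑-+ (λ z → δ y z * f y) (λ _ → c) ⟩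
    ∑ (λ z → δ y z * f y) + ∑ {n} (λ _ → c) ≡⟨ cong₂ _+_ (∑-δ (λ _ → f y) y) (∑-const n c) ⟩
    f y + n * c                            ∎
    where
    open ≡-Reasoning
    termwise : ∀ z → f z + δ y z * c ≡ δ y z * f y + c
    termwise z with y ≟ᶠ z
    ... | yes refl rewrite δ-refl y = cong₂ _+_ (sym (*-identityˡ (f y))) (*-identityˡ c)
    ... | no y≢z   rewrite δ-≢ y≢z = trans (+-identityʳ (f z)) (f≡c z y≢z)

  ∑-gram : ∀ {m} (λ' n : ℕ) (u : Fin m → ℕ) → (∀ y → u y * u y ≡ u y) →
    ∑ (λ y → ∑ (λ z → (λ' + n * δ y z) * (u y * u z))) ≡ λ' * (∑ u * ∑ u) + n * ∑ u
  ∑-gram λ' n u u-idem = begin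
    ∑ (λ y → ∑ (λ z → (λ' + n * δ y z) * (u y * u z)))
      ≡⟨ ∑-cong (λ y → ∑-cong (λ z → expand (δ y z) (u y) (u z))) ⟩
    ∑ (λ y → ∑ (λ z → λ' * u y * u z + u y * n * (δ y z * u z)))
      ≡⟨ ∑-cong (λ y → ∑-+ (λ z → λ' * u y * u z) (λ z → u y * n * (δ y z * u z))) ⟩
    ∑ (λ y → ∑ (λ z → λ' * u y * u z) + ∑ (λ z → u y * n * (δ y z * u z)))
      ≡⟨ ∑-cong (λ y → cong₂ _+_ (∑-*ˡ (λ' * u y) u) (trans (∑-*ˡ (u y * n) (λ z → δ y z * u z)) (cong (u y * n *_) (∑-δ u y)))) ⟩
    ∑ (λ y → λ' * u y * ∑ u + u y * n * u y)
      ≡⟨ ∑-cong (λ y → trans (reorder (u y) (∑ u)) (cong (λ t → λ' * ∑ u * u y + n * t) (u-idem y))) ⟩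
    ∑ (λ y → λ' * ∑ u * u y + n * u y)
      ≡⟨ trans (∑-+ (λ y → λ' * ∑ u * u y) (λ y → n * u y)) (cong₂ _+_ (∑-*ˡ (λ' * ∑ u) u) (∑-*ˡ n u)) ⟩
    λ' * ∑ u * ∑ u + n * ∑ u
      ≡⟨ cong (_+ n * ∑ u) (*-assoc λ' (∑ u) (∑ u)) ⟩
    λ' * (∑ u * ∑ u) + n * ∑ u ∎
    where
    open ≡-Reasoning
    expand : ∀ d a b → (λ' + n * d) * (a * b) ≡ λ' * a * b + a * n * (d * b)
    expand d a b = solve (λ' ∷ n ∷ d ∷ a ∷ b ∷ [])
    reorder : ∀ a s → λ' * a * s + a * n * a ≡ λ' * s * a + n * (a * a)
    reorder a s = solve (λ' ∷ n ∷ a ∷ s ∷ [])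

  ∑-square-gram : ∀ {a b} (λ' n : ℕ) (M : Fin a → Fin b → ℕ) →
    (∀ i i′ → ∑ (λ j → M i j * M i′ j) ≡ λ' + n * δ i i′) →
    (u : Fin a → ℕ) → (∀ i → u i * u i ≡ u i) →
    ∑ (λ j → ∑ (λ i → u i * M i j) * ∑ (λ i → u i * M i j)) ≡ λ' * (∑ u * ∑ u) + n * ∑ u
  ∑-square-gram λ' n M gram u u-idem = begin
    ∑ (λ j → ∑ (λ i → u i * M i j) * ∑ (λ i → u i * M i j))
      ≡⟨ ∑-cong (λ j → ∑-product (λ i → u i * M i j) (λ i → u i * M i j)) ⟩
    ∑ (λ j → ∑ (λ i → ∑ (λ i′ → (u i * M i j) * (u i′ * M i′ j))))
      ≡⟨ ∑-rotate (λ j i i′ → (u i * M i j) * (u i′ * M i′ j)) ⟩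
    ∑ (λ i → ∑ (λ i′ → ∑ (λ j → (u i * M i j) * (u i′ * M i′ j))))
      ≡⟨ ∑-cong (λ i → ∑-cong (λ i′ → pair i i′)) ⟩
    ∑ (λ i → ∑ (λ i′ → (λ' + n * δ i i′) * (u i * u i′)))
      ≡⟨ ∑-gram λ' n u u-idem ⟩
    λ' * (∑ u * ∑ u) + n * ∑ u ∎
    where
    open ≡-Reasoning
    swap : ∀ p q r s → (p * q) * (r * s) ≡ (q * s) * (p * r)
    swap p q r s = solve (p ∷ q ∷ r ∷ s ∷ [])
    pair : ∀ i i′ → ∑ (λ j → (u i * M i j) * (u i′ * M i′ j)) ≡ (λ' + n * δ i i′) * (u i * u i′)
    pair i i′ = begin
      ∑ (λ j → (u i * M i j) * (u i′ * M i′ j)) ≡⟨ ∑-cong (λ j → swap (u i) (M i j) (u i′) (M i′ j)) ⟩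
      ∑ (λ j → (M i j * M i′ j) * (u i * u i′)) ≡⟨ ∑-*ʳ (u i * u i′) (λ j → M i j * M i′ j) ⟩
      ∑ (λ j → M i j * M i′ j) * (u i * u i′)   ≡⟨ cong (_* (u i * u i′)) (gram i i′) ⟩
      (λ' + n * δ i i′) * (u i * u i′)           ∎

  ∑-linear : ∀ {a b} (M : Fin a → Fin b → ℕ) (u : Fin a → ℕ) →
    ∑ (λ j → ∑ (λ i → u i * M i j)) ≡ ∑ (λ i → u i * ∑ (M i))
  ∑-linear M u = trans (∑-comm (λ j i → u i * M i j)) (∑-cong (λ i → ∑-*ˡ (u i) (M i)))

  ∑-concentrated : ∀ {n} (f : Fin n → ℕ) y → ∑ f ≤ f y → ∀ z → y ≢ z → f z ≡ 0
  ∑-concentrated f y ∑≤fy z y≢z with f z in fz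
  ... | zero  = refl
  ... | suc _ = ⊥-elim (<⇒≱ (∑-mono-< (λ z′ → δ*≤ y z′ (f z′)) z δfz<fz) (≤-trans ∑≤fy (≤-reflexive (sym (∑-δ f y)))))
    where
    δfz<fz : δ y z * f z < f z
    δfz<fz rewrite δ-≢ y≢z | fz = s≤s z≤n

  ∑-vanishing-at : ∀ {w} (f : Fin (suc w) → ℕ) x d → f x ≡ 0 → (∀ z → x ≢ z → f z ≡ d) → ∑ f ≡ w * d
  ∑-vanishing-at {w} f x d fx≡0 f≡d = +-cancelʳ-≡ d _ _ (begin
    ∑ f + d          ≡⟨ ∑-except f d x f≡d ⟩
    f x + suc w * d  ≡⟨ cong (_+ suc w * d) fx≡0 ⟩
    d + w * d        ≡⟨ +-comm d (w * d) ⟩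
    w * d + d        ∎)
    where open ≡-Reasoning

  χ : Bool → ℕ
  χ true  = 1
  χ false = 0

  χ-∧ : ∀ a b → χ (a ∧ b) ≡ χ a * χ b
  χ-∧ true  b = sym (*-identityˡ (χ b))
  χ-∧ false b = refl

  χ-idem : ∀ a → χ a * χ a ≡ χ a
  χ-idem true  = refl
  χ-idem false = refl

  χ-not : ∀ a → χ a + χ (not a) ≡ 1
  χ-not true  = refl
  χ-not false = refl

  χ≤1 : ∀ a → χ a ≤ 1
  χ≤1 true  = s≤s z≤n
  χ≤1 false = z≤n

  χ-mono : ∀ {p q} → (p ≡ true → q ≡ true) → χ p ≤ χ q
  χ-mono {true}  p⇒q rewrite p⇒q refl = s≤s z≤n
  χ-mono {false} p⇒q = z≤n

  χ-true≤∑ : ∀ {n} (p : Fin n → Bool) y → p y ≡ true → 1 ≤ ∑ (λ z → χ (p z))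
  χ-true≤∑ p y py = ≤-trans (≤-reflexive (sym (cong χ py))) (term≤∑ (λ z → χ (p z)) y)

  χ-witness : ∀ {n} (p : Fin n → Bool) → 0 < ∑ (λ z → χ (p z)) → ∃ λ z → p z ≡ true
  χ-witness p pos with ∑-pos (λ z → χ (p z)) pos
  ... | z , χ>0 = z , lemma (p z) χ>0
    where
    lemma : ∀ a → 0 < χ a → a ≡ true
    lemma true _ = refl

  ∣tabulate∣ : ∀ {n} (p : Fin n → Bool) → ∣ tabulate p ∣ ≡ ∑ (λ i → χ (p i))
  ∣tabulate∣ {zero}  p = refl
  ∣tabulate∣ {suc n} p with p zero
  ... | true  = cong suc (∣tabulate∣ (λ i → p (suc i)))
  ... | false = ∣tabulate∣ (λ i → p (suc i))

  ⊆-size⇒⊇ : ∀ {n} (p q : Fin n → Bool) → (∀ z → p z ≡ true → q z ≡ true) →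
    ∑ (λ z → χ (q z)) ≤ ∑ (λ z → χ (p z)) → ∀ z → q z ≡ true → p z ≡ true
  ⊆-size⇒⊇ p q p⊆q q≤p z qz with p z in pz
  ... | true  = refl
  ... | false = ⊥-elim (<⇒≱ (∑-mono-< (λ z′ → χ-mono (p⊆q z′)) z pz<qz) q≤p)
    where
    pz<qz : χ (p z) < χ (q z)
    pz<qz rewrite pz | qz = s≤s z≤n

  others : ∀ {n} → Fin n → Fin n → Bool
  others x z = not (does (x ≟ᶠ z))

  ∑-others : ∀ {w} (x : Fin (suc w)) → ∑ (λ z → χ (others x z)) ≡ w
  ∑-others {w} x = +-cancelʳ-≡ 1 _ _ (begin
    ∑ (λ z → χ (others x z)) + 1 ≡⟨ ∑-except (λ z → χ (others x z)) 1 x off-x ⟩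
    χ (others x x) + suc w * 1   ≡⟨ cong (λ b → χ (not b) + suc w * 1) (dec-true (x ≟ᶠ x) refl) ⟩
    suc w * 1                    ≡⟨ *-identityʳ (suc w) ⟩
    1 + w                        ≡⟨ +-comm 1 w ⟩
    w + 1                        ∎)
    where
    open ≡-Reasoning
    off-x : ∀ z → x ≢ z → χ (others x z) ≡ 1
    off-x z x≢z = cong (λ b → χ (not b)) (dec-false (x ≟ᶠ z) x≢z)

-- The closure of a point y₀ under a finite family of permutations π t s and
-- their inverses, as a decidable subset of Fin n.  It is the least set
-- containing y₀ and invariant under the family; it is obtained by iterating a
-- one-step expansion, which strictly grows a non-invariant set, at most
-- n + 1 times.
module Closure {n a b : ℕ} (π : Fin a → Fin b → Permutation′ n) where

  open FinSum

  does-true : ∀ {A : Set} (a? : Dec A) → does a? ≡ true → A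
  does-true (yes a) _ = a

  BoolSet : Set
  BoolSet = Fin n → Bool

  OneStep : BoolSet → Fin n → Set
  OneStep o z = o z ≡ true ⊎
    ∃ λ t → ∃ λ s → o (π t s ⟨$⟩ˡ z) ≡ true ⊎ o (π t s ⟨$⟩ʳ z) ≡ true

  oneStep? : ∀ o z → Dec (OneStep o z)
  oneStep? o z = (o z Bool.≟ true) ⊎-dec any? λ t → any? λ s →
    (o (π t s ⟨$⟩ˡ z) Bool.≟ true) ⊎-dec (o (π t s ⟨$⟩ʳ z) Bool.≟ true)

  expand : BoolSet → BoolSet
  expand o z = does (oneStep? o z)

  expand-sound : ∀ o z → expand o z ≡ true → OneStep o z
  expand-sound o z = does-true (oneStep? o z)

  expand-⊇ : ∀ o z → o z ≡ true → expand o z ≡ true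
  expand-⊇ o z oz = dec-true (oneStep? o z) (inj₁ oz)

  expand-forward : ∀ o t s z → o z ≡ true → expand o (π t s ⟨$⟩ʳ z) ≡ true
  expand-forward o t s z oz = dec-true (oneStep? o _)
    (inj₂ (t , s , inj₁ (trans (cong o (inverseˡ (π t s))) oz)))

  expand-backward : ∀ o t s z → o z ≡ true → expand o (π t s ⟨$⟩ˡ z) ≡ true
  expand-backward o t s z oz = dec-true (oneStep? o _)
    (inj₂ (t , s , inj₂ (trans (cong o (inverseʳ (π t s))) oz)))

  Invariant : BoolSet → Set
  Invariant o = ∀ z → expand o z ≡ o z

  size : BoolSet → ℕ
  size o = ∑ (λ z → χ (o z))

  size≤n : ∀ o → size o ≤ n
  size≤n o = ≤-trans (∑-mono (λ z → χ≤1 (o z))) (≤-reflexive (trans (∑-const n 1) (*-identityʳ n)))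

  expand-grows : ∀ o → ¬ Invariant o → size o < size (expand o)
  expand-grows o not-inv with ¬∀⟶∃¬ n _ (λ z → expand o z Bool.≟ o z) not-inv
  ... | z , changed = ∑-mono-< (λ z′ → χ-mono (expand-⊇ o z′)) z (χ-strict (expand-⊇ o z) changed)
    where
    χ-strict : ∀ {p q} → (p ≡ true → q ≡ true) → q ≢ p → χ p < χ q
    χ-strict {true}          p⇒q q≢p = ⊥-elim (q≢p (p⇒q refl))
    χ-strict {false} {true}  p⇒q q≢p = s≤s z≤n
    χ-strict {false} {false} p⇒q q≢p = ⊥-elim (q≢p refl)

  iterate : ℕ → BoolSet → BoolSet
  iterate zero       o = o
  iterate (suc fuel) o with all? (λ z → expand o z Bool.≟ o z)
  ... | yes _ = o
  ... | no  _ = iterate fuel (expand o)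

  iterate-invariant : ∀ fuel o → n < size o + fuel → Invariant (iterate fuel o)
  iterate-invariant zero o n<size =
    ⊥-elim (<⇒≱ n<size (≤-trans (≤-reflexive (+-identityʳ (size o))) (size≤n o)))
  iterate-invariant (suc fuel) o n<size+fuel with all? (λ z → expand o z Bool.≟ o z)
  ... | yes inv = inv
  ... | no  not-inv = iterate-invariant fuel (expand o) (begin-strict
    n                        <⟨ n<size+fuel ⟩
    size o + suc fuel        ≡⟨ +-suc (size o) fuel ⟩
    suc (size o) + fuel      ≤⟨ +-monoˡ-≤ fuel (expand-grows o not-inv) ⟩
    size (expand o) + fuel   ∎)
    where open ≤-Reasoning

  iterate-preserves : (P : BoolSet → Set) → (∀ o → P o → P (expand o)) → ∀ fuel o → P o → P (iterate fuel o)
  iterate-preserves P P-expand zero       o Po = Po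
  iterate-preserves P P-expand (suc fuel) o Po with all? (λ z → expand o z Bool.≟ o z)
  ... | yes _ = Po
  ... | no  _ = iterate-preserves P P-expand fuel (expand o) (P-expand o Po)

  module _ (y₀ : Fin n) where

    singleton : BoolSet
    singleton z = does (y₀ ≟ᶠ z)

    closure : BoolSet
    closure = iterate (suc n) singleton

    closure-invariant : Invariant closure
    closure-invariant = iterate-invariant (suc n) singleton
      (≤-trans (s≤s (m≤n+m n (size singleton))) (≤-reflexive (sym (+-suc (size singleton) n))))

    closure-∋-y₀ : closure y₀ ≡ true
    closure-∋-y₀ = iterate-preserves (λ o → o y₀ ≡ true) (λ o → expand-⊇ o y₀) (suc n) singleton
      (dec-true (y₀ ≟ᶠ y₀) refl)

    closure-least : (R : Fin n → Set) → R y₀ →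
      (∀ t s z → R z → R (π t s ⟨$⟩ʳ z)) → (∀ t s z → R z → R (π t s ⟨$⟩ˡ z)) →
      ∀ z → closure z ≡ true → R z
    closure-least R Ry₀ R-forward R-backward =
      iterate-preserves (λ o → ∀ z → o z ≡ true → R z) closed (suc n) singleton R-singleton
      where
      R-singleton : ∀ z → singleton z ≡ true → R z
      R-singleton z e = subst R (does-true (y₀ ≟ᶠ z) e) Ry₀
      closed : ∀ o → (∀ z → o z ≡ true → R z) → ∀ z → expand o z ≡ true → R z
      closed o o⊆R z e with expand-sound o z e
      ... | inj₁ oz = o⊆R z oz
      ... | inj₂ (t , s , inj₁ o-back) = subst R (inverseʳ (π t s)) (R-forward t s _ (o⊆R _ o-back))
      ... | inj₂ (t , s , inj₂ o-fwd)  = subst R (inverseˡ (π t s)) (R-backward t s _ (o⊆R _ o-fwd))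

    closure-forward : ∀ t s z → closure z ≡ true → closure (π t s ⟨$⟩ʳ z) ≡ true
    closure-forward t s z cz = trans (sym (closure-invariant _)) (expand-forward closure t s z cz)

    closure-backward : ∀ t s z → closure (π t s ⟨$⟩ʳ z) ≡ true → closure z ≡ true
    closure-backward t s z cπz = trans (sym (closure-invariant z))
      (subst (λ u → expand closure u ≡ true) (inverseˡ (π t s)) (expand-backward closure t s _ cπz))

    closure-stable : ∀ t s z → closure (π t s ⟨$⟩ʳ z) ≡ closure z
    closure-stable t s z with closure z in cz | closure (π t s ⟨$⟩ʳ z) in cπz
    ... | true  | true  = refl
    ... | false | false = refl
    ... | true  | false = trans (sym cπz) (closure-forward t s z cz)
    ... | false | true  = trans (sym (closure-backward t s z cπz)) cz

-- a² + b² = 2ab + |a − b|², the identity behind the variance argument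
square-∣-∣-≤ : ∀ {a b} → a ≤ b → a * a + b * b ≡ 2 * a * b + ∣ a - b ∣ * ∣ a - b ∣
square-∣-∣-≤ {a} {b} a≤b = subst (λ c → a * a + c * c ≡ 2 * a * c + ∣ a - c ∣ * ∣ a - c ∣)
  (m+[n∸m]≡n a≤b) (shifted (b ∸ a))
  where
  shifted : ∀ t → a * a + (a + t) * (a + t) ≡ 2 * a * (a + t) + ∣ a - a + t ∣ * ∣ a - a + t ∣
  shifted t rewrite ∣m-m+n∣≡n a t = solve (a ∷ t ∷ [])

square-∣-∣ : ∀ a b → a * a + b * b ≡ 2 * a * b + ∣ a - b ∣ * ∣ a - b ∣
square-∣-∣ a b with ≤-total a b
... | inj₁ a≤b = square-∣-∣-≤ a≤b
... | inj₂ b≤a = begin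
  a * a + b * b                        ≡⟨ +-comm (a * a) (b * b) ⟩
  b * b + a * a                        ≡⟨ square-∣-∣-≤ b≤a ⟩
  2 * b * a + ∣ b - a ∣ * ∣ b - a ∣    ≡⟨ cong₂ (λ p d → p + d * d) 2ba≡2ab (∣-∣-comm b a) ⟩
  2 * a * b + ∣ a - b ∣ * ∣ a - b ∣    ∎
  where
  open ≡-Reasoning
  2ba≡2ab : 2 * b * a ≡ 2 * a * b
  2ba≡2ab = solve (a ∷ b ∷ [])

-- A symmetric 2-(v,k,λ) design with v = w + 1 points and blocks, block size
-- k = k₁ + 1 ≥ 2 and k < v.
module SymmetricDesign (w k₁ λ' : ℕ) (I : Incidence (suc w) (suc w))
  (design : IsSymmetricDesign (suc w) (suc k₁) λ' I) (k₁>0 : 0 < k₁) (k₁<w : k₁ < w) where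

  open FinSum

  v k : ℕ
  v = suc w
  k = suc k₁

  inc : Fin v → Fin v → ℕ
  inc y B = χ (I y B)

  block-size : ∀ B → ∑ (λ y → inc y B) ≡ k
  block-size B = trans (sym (∣tabulate∣ (λ y → I y B))) (proj₁ design B)

  pair-count : ∀ y z → y ≢ z → ∑ (λ B → inc y B * inc z B) ≡ λ'
  pair-count y z y≢z = begin
    ∑ (λ B → inc y B * inc z B)   ≡⟨ ∑-cong (λ B → sym (χ-∧ (I y B) (I z B))) ⟩
    ∑ (λ B → χ (I y B ∧ I z B))   ≡⟨ sym (∣tabulate∣ (λ B → I y B ∧ I z B)) ⟩
    ∣ blocksThrough I y z ∣        ≡⟨ proj₂ design y z y≢z ⟩
    λ'                            ∎
    where open ≡-Reasoning

  replication : Fin v → ℕ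
  replication y = ∑ (λ B → inc y B)

  -- counting pairs (z, B) with y, z ∈ B in two ways: r k = r + (v − 1) λ
  replication-equation : ∀ y → replication y * k₁ ≡ w * λ'
  replication-equation y = +-cancelˡ-≡ (r + λ') _ _ (begin
    r + λ' + r * k₁    ≡⟨ ring₁ r ⟩
    r * k + λ'         ≡⟨ cong (_+ λ') (sym two-way) ⟩
    ∑ common + λ'      ≡⟨ ∑-except common λ' y (pair-count y) ⟩
    common y + v * λ'  ≡⟨ cong (_+ v * λ') (∑-cong (λ B → χ-idem (I y B))) ⟩
    r + v * λ'         ≡⟨ ring₂ r ⟩
    r + λ' + w * λ'    ∎)
    where
    open ≡-Reasoning
    r : ℕ
    r = replication y
    ring₁ : ∀ r → r + λ' + r * k₁ ≡ r * suc k₁ + λ'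
    ring₁ r = solve (r ∷ λ' ∷ k₁ ∷ [])
    ring₂ : ∀ r → r + suc w * λ' ≡ r + λ' + w * λ'
    ring₂ r = solve (r ∷ λ' ∷ w ∷ [])
    common : Fin v → ℕ
    common z = ∑ (λ B → inc y B * inc z B)
    two-way : ∑ common ≡ r * k
    two-way = begin
      ∑ (λ z → ∑ (λ B → inc y B * inc z B)) ≡⟨ ∑-comm (λ z B → inc y B * inc z B) ⟩
      ∑ (λ B → ∑ (λ z → inc y B * inc z B)) ≡⟨ ∑-cong (λ B → trans (∑-*ˡ (inc y B) (λ z → inc z B)) (cong (inc y B *_) (block-size B))) ⟩
      ∑ (λ B → inc y B * k)                 ≡⟨ ∑-*ʳ k (λ B → inc y B) ⟩
      r * k                                 ∎

  instance
    k₁-nonZero : NonZero k₁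
    k₁-nonZero = >-nonZero k₁>0

  replication≡k : ∀ y → replication y ≡ k
  replication≡k y = trans (same y zero) (*-cancelˡ-≡ _ _ v (begin
    v * replication zero         ≡⟨ sym (∑-const v (replication zero)) ⟩
    ∑ {v} (λ _ → replication zero) ≡⟨ ∑-cong (λ z → same zero z) ⟩
    ∑ replication                ≡⟨ ∑-comm (λ z B → inc z B) ⟩
    ∑ (λ B → ∑ (λ z → inc z B))  ≡⟨ ∑-cong block-size ⟩
    ∑ {v} (λ _ → k)              ≡⟨ ∑-const v k ⟩
    v * k                        ∎))
    where
    open ≡-Reasoning
    same : ∀ y z → replication y ≡ replication z
    same y z = *-cancelʳ-≡ _ _ k₁ (trans (replication-equation y) (sym (replication-equation z)))

  k*k₁≡w*λ : k * k₁ ≡ w * λ'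
  k*k₁≡w*λ = trans (cong (_* k₁) (sym (replication≡k zero))) (replication-equation zero)

  λ<k : λ' < k
  λ<k = *-cancelˡ-< w λ' k (begin-strict
    w * λ'   ≡⟨ sym k*k₁≡w*λ ⟩
    k * k₁   <⟨ *-monoʳ-< k k₁<w ⟩
    k * w    ≡⟨ *-comm k w ⟩
    w * k    ∎)
    where open ≤-Reasoning

  n : ℕ
  n = k ∸ λ'

  λ+n≡k : λ' + n ≡ k
  λ+n≡k = m+[n∸m]≡n (<⇒≤ λ<k)

  n>0 : 0 < n
  n>0 = m<n⇒0<n∸m λ<k

  points-gram : ∀ y z → ∑ (λ B → inc y B * inc z B) ≡ λ' + n * δ y z
  points-gram y z with y ≟ᶠ z
  ... | yes refl = begin
    ∑ (λ B → inc y B * inc y B)  ≡⟨ ∑-cong (λ B → χ-idem (I y B)) ⟩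
    replication y                ≡⟨ replication≡k y ⟩
    k                            ≡⟨ sym λ+n≡k ⟩
    λ' + n                       ≡⟨ cong (λ' +_) (sym (*-identityʳ n)) ⟩
    λ' + n * 1                   ≡⟨ cong (λ d → λ' + n * d) (sym (δ-refl y)) ⟩
    λ' + n * δ y y               ∎
    where open ≡-Reasoning
  ... | no y≢z = begin
    ∑ (λ B → inc y B * inc z B)  ≡⟨ pair-count y z y≢z ⟩
    λ'                           ≡⟨ sym (+-identityʳ λ') ⟩
    λ' + 0                       ≡⟨ cong (λ d → λ' + d) (sym (*-zeroʳ n)) ⟩
    λ' + n * 0                   ≡⟨ cong (λ d → λ' + n * d) (sym (δ-≢ y≢z)) ⟩
    λ' + n * δ y z               ∎
    where open ≡-Reasoning

  -- λk² + nk + vλ² = 2λk² + n², from k = λ + n and k(k − 1) = (v − 1)λ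
  variance-identity : λ' * k * k + n * k + v * (λ' * λ') ≡ 2 * λ' * k * k + n * n
  variance-identity = +-cancelʳ-≡ (λ' * k) _ _ (begin
    λ' * k * k + n * k + v * (λ' * λ') + λ' * k
      ≡⟨ expand-v λ' n k₁ w ⟩
    λ' * k * k + n * k + λ' * λ' + (w * λ') * λ' + λ' * k
      ≡⟨ cong (λ p → λ' * k * k + n * k + λ' * λ' + p * λ' + λ' * k) k*k₁≡w*λ ⟨
    λ' * k * k + n * k + λ' * λ' + (k * k₁) * λ' + λ' * k
      ≡⟨ collect-k λ' n k₁ ⟩
    2 * λ' * k * k + n * k + λ' * λ'
      ≡⟨ cong (λ p → 2 * λ' * k * k + n * p + λ' * λ') λ+n≡k ⟨
    2 * λ' * k * k + n * (λ' + n) + λ' * λ'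
      ≡⟨ complete-square λ' n k ⟩
    2 * λ' * k * k + n * n + (λ' + n) * λ'
      ≡⟨ cong (λ p → 2 * λ' * k * k + n * n + p * λ') λ+n≡k ⟩
    2 * λ' * k * k + n * n + k * λ'
      ≡⟨ cong (2 * λ' * k * k + n * n +_) (*-comm k λ') ⟩
    2 * λ' * k * k + n * n + λ' * k ∎)
    where
    open ≡-Reasoning
    expand-v : ∀ l n k₁ w → l * suc k₁ * suc k₁ + n * suc k₁ + suc w * (l * l) + l * suc k₁
                          ≡ l * suc k₁ * suc k₁ + n * suc k₁ + l * l + (w * l) * l + l * suc k₁
    expand-v l n k₁ w = solve (l ∷ n ∷ k₁ ∷ w ∷ [])
    collect-k : ∀ l n k₁ → l * suc k₁ * suc k₁ + n * suc k₁ + l * l + (suc k₁ * k₁) * l + l * suc k₁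
                         ≡ 2 * l * suc k₁ * suc k₁ + n * suc k₁ + l * l
    collect-k l n k₁ = solve (l ∷ n ∷ k₁ ∷ [])
    complete-square : ∀ l n K → 2 * l * K * K + n * (l + n) + l * l ≡ 2 * l * K * K + n * n + (l + n) * l
    complete-square l n K = solve (l ∷ n ∷ K ∷ [])

  -- Nᵀ N = nI + λJ: two distinct blocks meet in λ points.  For a fixed block
  -- B the intersection sizes |B ∩ C| have mean λ and variance 0 over C ≠ B.
  module Dual (B : Fin v) where

    meet : Fin v → ℕ
    meet C = ∑ (λ y → inc y B * inc y C)

    ∑-meet : ∑ meet ≡ k * k
    ∑-meet = begin
      ∑ meet                               ≡⟨ ∑-linear inc (λ y → inc y B) ⟩
      ∑ (λ y → inc y B * replication y)    ≡⟨ ∑-cong (λ y → cong (inc y B *_) (replication≡k y)) ⟩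
      ∑ (λ y → inc y B * k)                ≡⟨ ∑-*ʳ k (λ y → inc y B) ⟩
      ∑ (λ y → inc y B) * k                ≡⟨ cong (_* k) (block-size B) ⟩
      k * k                                ∎
      where open ≡-Reasoning

    ∑-meet² : ∑ (λ C → meet C * meet C) ≡ λ' * k * k + n * k
    ∑-meet² = begin
      ∑ (λ C → meet C * meet C)                                      ≡⟨ ∑-square-gram λ' n inc points-gram (λ y → inc y B) (λ y → χ-idem (I y B)) ⟩
      λ' * (∑ (λ y → inc y B) * ∑ (λ y → inc y B)) + n * ∑ (λ y → inc y B) ≡⟨ cong (λ s → λ' * (s * s) + n * s) (block-size B) ⟩
      λ' * (k * k) + n * k                                           ≡⟨ cong (_+ n * k) (sym (*-assoc λ' k k)) ⟩
      λ' * k * k + n * k                                             ∎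
      where open ≡-Reasoning

    deviation : Fin v → ℕ
    deviation C = ∣ λ' - meet C ∣ * ∣ λ' - meet C ∣

    ∑-deviation : ∑ deviation ≡ n * n
    ∑-deviation = +-cancelˡ-≡ (2 * λ' * k * k) _ _ (begin
      2 * λ' * k * k + ∑ deviation                    ≡⟨ cong (_+ ∑ deviation) (*-assoc (2 * λ') k k) ⟩
      2 * λ' * (k * k) + ∑ deviation                  ≡⟨ cong (λ s → 2 * λ' * s + ∑ deviation) ∑-meet ⟨
      2 * λ' * ∑ meet + ∑ deviation                   ≡⟨ cong (_+ ∑ deviation) (∑-*ˡ (2 * λ') meet) ⟨
      ∑ (λ C → 2 * λ' * meet C) + ∑ deviation         ≡⟨ ∑-+ (λ C → 2 * λ' * meet C) deviation ⟨
      ∑ (λ C → 2 * λ' * meet C + deviation C)         ≡⟨ ∑-cong (λ C → square-∣-∣ λ' (meet C)) ⟨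
      ∑ (λ C → λ' * λ' + meet C * meet C)             ≡⟨ ∑-+ (λ _ → λ' * λ') (λ C → meet C * meet C) ⟩
      ∑ {v} (λ _ → λ' * λ') + ∑ (λ C → meet C * meet C) ≡⟨ cong₂ _+_ (∑-const v (λ' * λ')) ∑-meet² ⟩
      v * (λ' * λ') + (λ' * k * k + n * k)            ≡⟨ +-comm (v * (λ' * λ')) _ ⟩
      λ' * k * k + n * k + v * (λ' * λ')              ≡⟨ variance-identity ⟩
      2 * λ' * k * k + n * n                          ∎)
      where open ≡-Reasoning

    meet-self : meet B ≡ k
    meet-self = trans (∑-cong (λ y → χ-idem (I y B))) (block-size B)

    meet-other : ∀ C → B ≢ C → meet C ≡ λ'
    meet-other C B≢C = sym (∣m-n∣≡0⇒m≡n (m*m≡0⇒m≡0 (∑-concentrated deviation B all-at-B C B≢C)))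
      where
      all-at-B : ∑ deviation ≤ deviation B
      all-at-B = ≤-reflexive (begin
        ∑ deviation                   ≡⟨ ∑-deviation ⟩
        n * n                         ≡⟨ cong (λ d → d * d) (m≤n⇒∣m-n∣≡n∸m (<⇒≤ λ<k)) ⟨
        ∣ λ' - k ∣ * ∣ λ' - k ∣       ≡⟨ cong (λ m → ∣ λ' - m ∣ * ∣ λ' - m ∣) meet-self ⟨
        deviation B                   ∎)
        where open ≡-Reasoning
      m*m≡0⇒m≡0 : ∀ {m} → m * m ≡ 0 → m ≡ 0
      m*m≡0⇒m≡0 {zero} _ = refl

  blocks-gram : ∀ B C → ∑ (λ y → inc y B * inc y C) ≡ λ' + n * δ B C
  blocks-gram B C with B ≟ᶠ C
  ... | yes refl = begin
    ∑ (λ y → inc y B * inc y B)  ≡⟨ Dual.meet-self B ⟩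
    k                            ≡⟨ sym λ+n≡k ⟩
    λ' + n                       ≡⟨ cong (λ' +_) (sym (*-identityʳ n)) ⟩
    λ' + n * 1                   ≡⟨ cong (λ d → λ' + n * d) (sym (δ-refl B)) ⟩
    λ' + n * δ B B               ∎
    where open ≡-Reasoning
  ... | no B≢C = begin
    ∑ (λ y → inc y B * inc y C)  ≡⟨ Dual.meet-other B C B≢C ⟩
    λ'                           ≡⟨ sym (+-identityʳ λ') ⟩
    λ' + 0                       ≡⟨ cong (λ d → λ' + d) (sym (*-zeroʳ n)) ⟩
    λ' + n * 0                   ≡⟨ cong (λ d → λ' + n * d) (sym (δ-≢ B≢C)) ⟩
    λ' + n * δ B C               ∎
    where open ≡-Reasoning

  block-ext : ∀ B C → (∀ y → I y C ≡ I y B) → C ≡ B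
  block-ext B C same with C ≟ᶠ B
  ... | yes C≡B = C≡B
  ... | no  C≢B = ⊥-elim (<⇒≢ λ<k (begin
    λ'                             ≡⟨ Dual.meet-other C B C≢B ⟨
    ∑ (λ y → inc y C * inc y B)    ≡⟨ ∑-cong (λ y → cong (λ b → inc y C * χ b) (same y)) ⟨
    ∑ (λ y → inc y C * inc y C)    ≡⟨ Dual.meet-self C ⟩
    k                              ∎))
    where open ≡-Reasoning


  e : ℕ
  e = w ∸ k₁

  k+e≡v : k + e ≡ v
  k+e≡v = cong suc (m+[n∸m]≡n (<⇒≤ k₁<w))

  blocks-missing : ∀ x → ∑ (λ B → χ (not (I x B))) ≡ e
  blocks-missing x = +-cancelˡ-≡ k _ _ (begin
    k + ∑ (λ B → χ (not (I x B)))                     ≡⟨ cong (_+ ∑ (λ B → χ (not (I x B)))) (replication≡k x) ⟨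
    replication x + ∑ (λ B → χ (not (I x B)))         ≡⟨ ∑-+ (λ B → inc x B) (λ B → χ (not (I x B))) ⟨
    ∑ (λ B → inc x B + χ (not (I x B)))               ≡⟨ ∑-cong (λ B → χ-not (I x B)) ⟩
    ∑ {v} (λ _ → 1)                                   ≡⟨ trans (∑-const v 1) (*-identityʳ v) ⟩
    v                                                 ≡⟨ k+e≡v ⟨
    k + e                                             ∎)
    where open ≡-Reasoning


  e*λ≡k₁*n : e * λ' ≡ k₁ * n
  e*λ≡k₁*n = +-cancelˡ-≡ (k₁ * λ') _ _ (begin
    k₁ * λ' + e * λ'   ≡⟨ *-distribʳ-+ λ' k₁ e ⟨
    (k₁ + e) * λ'      ≡⟨ cong (_* λ') (m+[n∸m]≡n (<⇒≤ k₁<w)) ⟩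
    w * λ'             ≡⟨ k*k₁≡w*λ ⟨
    k * k₁             ≡⟨ cong (_* k₁) λ+n≡k ⟨
    (λ' + n) * k₁      ≡⟨ *-distribʳ-+ k₁ λ' n ⟩
    λ' * k₁ + n * k₁   ≡⟨ cong₂ _+_ (*-comm λ' k₁) (*-comm n k₁) ⟩
    k₁ * λ' + k₁ * n   ∎)
    where open ≡-Reasoning

  k*e≡n*w : k * e ≡ n * w
  k*e≡n*w = begin
    k * e               ≡⟨ cong (_* e) λ+n≡k ⟨
    (λ' + n) * e        ≡⟨ *-distribʳ-+ e λ' n ⟩
    λ' * e + n * e      ≡⟨ cong (_+ n * e) (trans (*-comm λ' e) e*λ≡k₁*n) ⟩
    k₁ * n + n * e      ≡⟨ cong (_+ n * e) (*-comm k₁ n) ⟩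
    n * k₁ + n * e      ≡⟨ *-distribˡ-+ n k₁ e ⟨
    n * (k₁ + e)        ≡⟨ cong (n *_) (m+[n∸m]≡n (<⇒≤ k₁<w)) ⟩
    n * w               ∎
    where open ≡-Reasoning


  block-through : ∀ x → ∃ λ B → I x B ≡ true
  block-through x = χ-witness (I x) (subst (0 <_) (sym (replication≡k x)) (s≤s z≤n))

  block-missing : ∀ x → ∃ λ B → I x B ≡ false
  block-missing x = proj₁ found , Bool.not-injective (proj₂ found)
    where
    found : ∃ λ B → not (I x B) ≡ true
    found = χ-witness (λ B → not (I x B)) (subst (0 <_) (sym (blocks-missing x)) (m<n⇒0<n∸m k₁<w))

  point-on : ∀ B → ∃ λ y → I y B ≡ true
  point-on B = χ-witness (λ y → I y B) (subst (0 <_) (sym (block-size B)) (s≤s z≤n))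

  ∑-by-incidence : ∀ x (F : Fin v → ℕ) s t → (∀ B → I x B ≡ true → F B ≡ s) → (∀ B → I x B ≡ false → F B ≡ t) →
    ∑ F ≡ k * s + e * t
  ∑-by-incidence x F s t on off = begin
    ∑ F                                                 ≡⟨ ∑-cong split ⟩
    ∑ (λ B → inc x B * s + χ (not (I x B)) * t)         ≡⟨ ∑-+ (λ B → inc x B * s) (λ B → χ (not (I x B)) * t) ⟩
    ∑ (λ B → inc x B * s) + ∑ (λ B → χ (not (I x B)) * t) ≡⟨ cong₂ _+_ (∑-*ʳ s (inc x)) (∑-*ʳ t (λ B → χ (not (I x B)))) ⟩
    replication x * s + ∑ (λ B → χ (not (I x B))) * t   ≡⟨ cong₂ (λ p q → p * s + q * t) (replication≡k x) (blocks-missing x) ⟩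
    k * s + e * t                                       ∎
    where
    open ≡-Reasoning
    split : ∀ B → F B ≡ inc x B * s + χ (not (I x B)) * t
    split B with I x B in xB
    ... | true  = trans (on B xB) (sym (trans (+-identityʳ (s + 0)) (+-identityʳ s)))
    ... | false = trans (off B xB) (sym (+-identityʳ t))

  points-arithmetic : ∀ a c m → 0 < m → k * a ≡ λ' * m → k * a + e * c ≡ k * m →
    k * (a * a) + e * (c * c) ≡ λ' * (m * m) + n * m → m ≡ w
  points-arithmetic a c m m>0 ka≡λm sum-eq square-eq =
    *-cancelʳ-≡ m w n (+-cancelˡ-≡ (k₁ * n * m) _ _ (+-cancelˡ-≡ (k₁ * λ' * m) _ _ (begin
      k₁ * λ' * m + (k₁ * n * m + m * n)  ≡⟨ collect-k k₁ λ' n m ⟩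
      k₁ * λ' * m + k * n * m             ≡⟨ *-cancelˡ-≡ _ _ (n * m) scaled ⟩
      k * k₁ * m + w * n                  ≡⟨ cong (λ K → K * k₁ * m + w * n) λ+n≡k ⟨
      (λ' + n) * k₁ * m + w * n           ≡⟨ expand-λ+n k₁ λ' n m w ⟩
      k₁ * λ' * m + (k₁ * n * m + w * n)  ∎)))
    where
    open ≡-Reasoning
    instance
      nm-nonZero : NonZero (n * m)
      nm-nonZero = m*n≢0 n m ⦃ >-nonZero n>0 ⦄ ⦃ >-nonZero m>0 ⦄
      n-nonZero : NonZero n
      n-nonZero = >-nonZero n>0
    ec≡nm : e * c ≡ n * m
    ec≡nm = +-cancelˡ-≡ (k * a) _ _ (begin
      k * a + e * c   ≡⟨ sum-eq ⟩
      k * m           ≡⟨ cong (_* m) λ+n≡k ⟨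
      (λ' + n) * m    ≡⟨ *-distribʳ-+ m λ' n ⟩
      λ' * m + n * m  ≡⟨ cong (_+ n * m) ka≡λm ⟨
      k * a + n * m   ∎)
    distribute-nm : ∀ n m k₁ l K → n * m * (k₁ * l * m + K * n * m) ≡ k₁ * n * l * (m * m) + K * ((n * m) * (n * m))
    distribute-nm n m k₁ l K = solve (n ∷ m ∷ k₁ ∷ l ∷ K ∷ [])
    group-λm : ∀ e l m K n → e * l * l * (m * m) + K * ((n * m) * (n * m)) ≡ e * ((l * m) * (l * m)) + K * ((n * m) * (n * m))
    group-λm e l m K n = solve (e ∷ l ∷ m ∷ K ∷ n ∷ [])
    factor-ke : ∀ e K a c → e * ((K * a) * (K * a)) + K * ((e * c) * (e * c)) ≡ K * e * (K * (a * a) + e * (c * c))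
    factor-ke e K a c = solve (e ∷ K ∷ a ∷ c ∷ [])
    regroup-nm : ∀ n w l m → n * w * (l * (m * m) + n * m) ≡ n * m * (w * l * m + w * n)
    regroup-nm n w l m = solve (n ∷ w ∷ l ∷ m ∷ [])
    collect-k : ∀ k₁ l n m → k₁ * l * m + (k₁ * n * m + m * n) ≡ k₁ * l * m + suc k₁ * n * m
    collect-k k₁ l n m = solve (k₁ ∷ l ∷ n ∷ m ∷ [])
    expand-λ+n : ∀ k₁ l n m w → (l + n) * k₁ * m + w * n ≡ k₁ * l * m + (k₁ * n * m + w * n)
    expand-λ+n k₁ l n m w = solve (k₁ ∷ l ∷ n ∷ m ∷ w ∷ [])

    -- the square equation multiplied by k e, rewritten with eλ = k₁ n and ke = n w
    scaled : n * m * (k₁ * λ' * m + k * n * m) ≡ n * m * (k * k₁ * m + w * n)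
    scaled = begin
      n * m * (k₁ * λ' * m + k * n * m)             ≡⟨ distribute-nm n m k₁ λ' k ⟩
      k₁ * n * λ' * (m * m) + k * ((n * m) * (n * m)) ≡⟨ cong (λ p → p * λ' * (m * m) + k * ((n * m) * (n * m))) e*λ≡k₁*n ⟨
      e * λ' * λ' * (m * m) + k * ((n * m) * (n * m)) ≡⟨ group-λm e λ' m k n ⟩
      e * ((λ' * m) * (λ' * m)) + k * ((n * m) * (n * m)) ≡⟨ cong₂ (λ p q → e * (p * p) + k * (q * q)) ka≡λm ec≡nm ⟨
      e * ((k * a) * (k * a)) + k * ((e * c) * (e * c)) ≡⟨ factor-ke e k a c ⟩
      k * e * (k * (a * a) + e * (c * c))           ≡⟨ cong (k * e *_) square-eq ⟩
      k * e * (λ' * (m * m) + n * m)                ≡⟨ cong (λ p → p * (λ' * (m * m) + n * m)) k*e≡n*w ⟩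
      n * w * (λ' * (m * m) + n * m)                ≡⟨ regroup-nm n w λ' m ⟩
      n * m * (w * λ' * m + w * n)                  ≡⟨ cong (λ p → n * m * (p * m + w * n)) k*k₁≡w*λ ⟨
      n * m * (k * k₁ * m + w * n)                  ∎

  blocks-arithmetic : ∀ d M → 0 < M → w * d ≡ k * M → w * (d * d) ≡ λ' * (M * M) + n * M → M ≡ e
  blocks-arithmetic d M M>0 wd≡kM square-eq =
    *-cancelˡ-≡ M e k (*-cancelʳ-≡ (k * M) (k * e) M ⦃ >-nonZero M>0 ⦄ (+-cancelˡ-≡ (k * k₁ * (M * M)) _ _ (begin
      k * k₁ * (M * M) + k * M * M        ≡⟨ square-kM k₁ M ⟩
      (k * M) * (k * M)                   ≡⟨ cong (λ p → p * p) wd≡kM ⟨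
      (w * d) * (w * d)                   ≡⟨ square-wd w d ⟩
      w * (w * (d * d))                   ≡⟨ cong (w *_) square-eq ⟩
      w * (λ' * (M * M) + n * M)          ≡⟨ distribute-w w λ' M n ⟩
      w * λ' * (M * M) + n * w * M        ≡⟨ cong₂ (λ p q → p * (M * M) + q * M) k*k₁≡w*λ k*e≡n*w ⟨
      k * k₁ * (M * M) + k * e * M        ∎)))
    where
    open ≡-Reasoning
    square-kM : ∀ k₁ M → suc k₁ * k₁ * (M * M) + suc k₁ * M * M ≡ (suc k₁ * M) * (suc k₁ * M)
    square-kM k₁ M = solve (k₁ ∷ M ∷ [])
    square-wd : ∀ w d → (w * d) * (w * d) ≡ w * (w * (d * d))
    square-wd w d = solve (w ∷ d ∷ [])
    distribute-w : ∀ w l M n → w * (l * (M * M) + n * M) ≡ w * l * (M * M) + n * w * M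
    distribute-w w l M n = solve (w ∷ l ∷ M ∷ n ∷ [])

  meets : (Fin v → Bool) → Fin v → ℕ
  meets o B = ∑ (λ y → χ (o y) * inc y B)

  degree : (Fin v → Bool) → Fin v → ℕ
  degree q y = ∑ (λ B → χ (q B) * inc y B)

  flags-through : ∀ x (o : Fin v → Bool) →
    ∑ (λ B → inc x B * meets o B) ≡ λ' * ∑ (λ y → χ (o y)) + n * χ (o x)
  flags-through x o = begin
    ∑ (λ B → inc x B * ∑ (λ y → u y * inc y B))      ≡⟨ ∑-cong (λ B → sym (∑-*ˡ (inc x B) (λ y → u y * inc y B))) ⟩
    ∑ (λ B → ∑ (λ y → inc x B * (u y * inc y B)))    ≡⟨ ∑-comm (λ B y → inc x B * (u y * inc y B)) ⟩
    ∑ (λ y → ∑ (λ B → inc x B * (u y * inc y B)))    ≡⟨ ∑-cong (λ y → ∑-cong (λ B → rearrange (inc x B) (u y) (inc y B))) ⟩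
    ∑ (λ y → ∑ (λ B → u y * (inc x B * inc y B)))    ≡⟨ ∑-cong (λ y → trans (∑-*ˡ (u y) (λ B → inc x B * inc y B)) (cong (u y *_) (points-gram x y))) ⟩
    ∑ (λ y → u y * (λ' + n * δ x y))                 ≡⟨ ∑-cong (λ y → distribute (u y) (δ x y) n) ⟩
    ∑ (λ y → λ' * u y + n * (δ x y * u y))           ≡⟨ ∑-+ (λ y → λ' * u y) (λ y → n * (δ x y * u y)) ⟩
    ∑ (λ y → λ' * u y) + ∑ (λ y → n * (δ x y * u y)) ≡⟨ cong₂ _+_ (∑-*ˡ λ' u) (trans (∑-*ˡ n (λ y → δ x y * u y)) (cong (n *_) (∑-δ u x))) ⟩
    λ' * ∑ u + n * u x                               ∎
    where
    open ≡-Reasoning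
    u : Fin v → ℕ
    u y = χ (o y)
    rearrange : ∀ p q r → p * (q * r) ≡ q * (p * r)
    rearrange p q r = solve (p ∷ q ∷ r ∷ [])
    distribute : ∀ a d n → a * (λ' + n * d) ≡ λ' * a + n * (d * a)
    distribute a d n = solve (a ∷ d ∷ λ' ∷ n ∷ [])

  uniform-point-set : ∀ x (o : Fin v → Bool) → o x ≡ false → (∃ λ y → o y ≡ true) →
    (∀ B C → I x B ≡ I x C → meets o B ≡ meets o C) → ∀ z → x ≢ z → o z ≡ true
  uniform-point-set x o x∉O (y₀ , y₀∈O) uniform z x≢z =
    ⊆-size⇒⊇ o (others x) O⊆others (≤-reflexive (trans (∑-others x) (sym m≡w))) z
      (cong not (dec-false (x ≟ᶠ z) x≢z))
    where
    u : Fin v → ℕ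
    u y = χ (o y)
    m : ℕ
    m = ∑ u
    B₁ C₁ : Fin v
    B₁ = proj₁ (block-through x)
    C₁ = proj₁ (block-missing x)
    a c : ℕ
    a = meets o B₁
    c = meets o C₁
    on : ∀ B → I x B ≡ true → meets o B ≡ a
    on B x∈B = uniform B B₁ (trans x∈B (sym (proj₂ (block-through x))))
    off : ∀ B → I x B ≡ false → meets o B ≡ c
    off B x∉B = uniform B C₁ (trans x∉B (sym (proj₂ (block-missing x))))
    through-x : k * a ≡ λ' * m
    through-x = begin
      k * a                              ≡⟨ trans (sym (+-identityʳ (k * a))) (cong (k * a +_) (sym (*-zeroʳ e))) ⟩
      k * a + e * 0                      ≡⟨ ∑-by-incidence x (λ B → inc x B * meets o B) a 0
                                              (λ B x∈B → trans (cong (λ b → χ b * meets o B) x∈B) (trans (*-identityˡ _) (on B x∈B)))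
                                              (λ B x∉B → cong (λ b → χ b * meets o B) x∉B) ⟨
      ∑ (λ B → inc x B * meets o B)      ≡⟨ flags-through x o ⟩
      λ' * m + n * u x                   ≡⟨ cong (λ b → λ' * m + n * χ b) x∉O ⟩
      λ' * m + n * 0                     ≡⟨ trans (cong (λ' * m +_) (*-zeroʳ n)) (+-identityʳ (λ' * m)) ⟩
      λ' * m                             ∎
      where open ≡-Reasoning
    all-blocks : k * a + e * c ≡ k * m
    all-blocks = begin
      k * a + e * c                      ≡⟨ ∑-by-incidence x (meets o) a c on off ⟨
      ∑ (meets o)                        ≡⟨ ∑-linear inc u ⟩
      ∑ (λ y → u y * replication y)      ≡⟨ ∑-cong (λ y → trans (cong (u y *_) (replication≡k y)) (*-comm (u y) k)) ⟩
      ∑ (λ y → k * u y)                  ≡⟨ ∑-*ˡ k u ⟩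
      k * m                              ∎
      where open ≡-Reasoning
    squares : k * (a * a) + e * (c * c) ≡ λ' * (m * m) + n * m
    squares = begin
      k * (a * a) + e * (c * c)          ≡⟨ ∑-by-incidence x (λ B → meets o B * meets o B) (a * a) (c * c)
                                              (λ B x∈B → cong (λ t → t * t) (on B x∈B)) (λ B x∉B → cong (λ t → t * t) (off B x∉B)) ⟨
      ∑ (λ B → meets o B * meets o B)    ≡⟨ ∑-square-gram λ' n inc points-gram u (λ y → χ-idem (o y)) ⟩
      λ' * (m * m) + n * m               ∎
      where open ≡-Reasoning
    m≡w : m ≡ w
    m≡w = points-arithmetic a c m (χ-true≤∑ o y₀ y₀∈O) through-x all-blocks squares
    O⊆others : ∀ y → o y ≡ true → others x y ≡ true
    O⊆others y y∈O = cong not (dec-false (x ≟ᶠ y) (λ x≡y → false≢true (trans (sym x∉O) (trans (cong o x≡y) y∈O))))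
      where
      false≢true : false ≢ true
      false≢true ()

  uniform-block-set : ∀ x (q : Fin v → Bool) → (∀ B → q B ≡ true → I x B ≡ false) → (∃ λ B → q B ≡ true) →
    (∀ y z → x ≢ y → x ≢ z → degree q y ≡ degree q z) → ∀ C → I x C ≡ false → q C ≡ true
  uniform-block-set x q Q-misses-x (B₀ , B₀∈Q) uniform C x∉C =
    ⊆-size⇒⊇ q (λ C → not (I x C)) (λ C C∈Q → cong not (Q-misses-x C C∈Q))
      (≤-reflexive (trans (blocks-missing x) (sym M≡e))) C (cong not x∉C)
    where
    u : Fin v → ℕ
    u B = χ (q B)
    M : ℕ
    M = ∑ u
    y₁ : Fin v
    y₁ = proj₁ (point-on B₀)
    x≢y₁ : x ≢ y₁
    x≢y₁ x≡y₁ = false≢true (trans (sym (Q-misses-x B₀ B₀∈Q)) (trans (cong (λ y → I y B₀) x≡y₁) (proj₂ (point-on B₀))))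
      where
      false≢true : false ≢ true
      false≢true ()
    d : ℕ
    d = degree q y₁
    degree-x : degree q x ≡ 0
    degree-x = trans (∑-cong no-flag) (trans (∑-const v 0) (*-zeroʳ v))
      where
      no-flag : ∀ B → χ (q B) * inc x B ≡ 0
      no-flag B with q B in qB
      ... | true  = cong (λ b → 1 * χ b) (Q-misses-x B qB)
      ... | false = refl
    off-x : ∀ y → x ≢ y → degree q y ≡ d
    off-x y x≢y = uniform y y₁ x≢y x≢y₁
    degrees : w * d ≡ k * M
    degrees = begin
      w * d                                   ≡⟨ ∑-vanishing-at (degree q) x d degree-x off-x ⟨
      ∑ (degree q)                            ≡⟨ ∑-linear (λ B y → inc y B) u ⟩
      ∑ (λ B → u B * ∑ (λ y → inc y B))       ≡⟨ ∑-cong (λ B → trans (cong (u B *_) (block-size B)) (*-comm (u B) k)) ⟩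
      ∑ (λ B → k * u B)                       ≡⟨ ∑-*ˡ k u ⟩
      k * M                                   ∎
      where open ≡-Reasoning
    squares : w * (d * d) ≡ λ' * (M * M) + n * M
    squares = begin
      w * (d * d)                             ≡⟨ ∑-vanishing-at (λ y → degree q y * degree q y) x (d * d)
                                                   (cong (λ t → t * t) degree-x) (λ y x≢y → cong (λ t → t * t) (off-x y x≢y)) ⟨
      ∑ (λ y → degree q y * degree q y)       ≡⟨ ∑-square-gram λ' n (λ B y → inc y B) blocks-gram u (λ B → χ-idem (q B)) ⟩
      λ' * (M * M) + n * M                    ∎
      where open ≡-Reasoning
    M≡e : M ≡ e
    M≡e = blocks-arithmetic d M (χ-true≤∑ q B₀ B₀∈Q) degrees squares

module FlagTransitiveGroup (w k₁ λ' : ℕ) (I : Incidence (suc w) (suc w))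
  (design : IsSymmetricDesign (suc w) (suc k₁) λ' I) (k₁>0 : 0 < k₁) (k₁<w : k₁ < w)
  (G : Permutation′ (suc w) → Set) (aut-group : IsAutGroup I G) (flag-transitive : FlagTransitive I G) where

  open FinSum
  open SymmetricDesign w k₁ λ' I design k₁>0 k₁<w

  Perm : Set
  Perm = Permutation′ v

  automorphism : ∀ g → G g → IsAutomorphism I g
  automorphism = proj₁ aut-group

  G-id : G id
  G-id = proj₁ (proj₂ aut-group)

  G-∘ : ∀ g h → G g → G h → G (g ∘ₚ h)
  G-∘ = proj₁ (proj₂ (proj₂ aut-group))

  G-flip : ∀ g → G g → G (flip g)
  G-flip = proj₂ (proj₂ (proj₂ aut-group))

  Stabilises : Fin v → Perm → Set
  Stabilises x g = G g × g ⟨$⟩ʳ x ≡ x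

  stabiliser-∘ : ∀ {x g h} → Stabilises x g → Stabilises x h → Stabilises x (g ∘ₚ h)
  stabiliser-∘ {x} {g} {h} (g∈G , gx) (h∈G , hx) = G-∘ g h g∈G h∈G , trans (cong (h ⟨$⟩ʳ_) gx) hx

  stabiliser-flip : ∀ {x g} → Stabilises x g → Stabilises x (flip g)
  stabiliser-flip {x} {g} (g∈G , gx) = G-flip g g∈G , trans (cong (g ⟨$⟩ˡ_) (sym gx)) (inverseˡ g)

  maps-∘ : ∀ g h {B C E} → MapsBlock I g B C → MapsBlock I h C E → MapsBlock I (g ∘ₚ h) B E
  maps-∘ g h g-maps h-maps z = trans (h-maps (g ⟨$⟩ʳ z)) (g-maps z)

  maps-flip : ∀ g {B C} → MapsBlock I g B C → MapsBlock I (flip g) C B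
  maps-flip g {C = C} g-maps z = trans (sym (g-maps (g ⟨$⟩ˡ z))) (cong (λ y → I y C) (inverseʳ g))

  maps-unique : ∀ g {B C C′} → MapsBlock I g B C → MapsBlock I g B C′ → C′ ≡ C
  maps-unique g {B} {C} {C′} to-C to-C′ = block-ext C C′ λ y → begin
    I y C′                     ≡⟨ cong (λ t → I t C′) (inverseʳ g) ⟨
    I (g ⟨$⟩ʳ (g ⟨$⟩ˡ y)) C′   ≡⟨ to-C′ (g ⟨$⟩ˡ y) ⟩
    I (g ⟨$⟩ˡ y) B             ≡⟨ to-C (g ⟨$⟩ˡ y) ⟨
    I (g ⟨$⟩ʳ (g ⟨$⟩ˡ y)) C    ≡⟨ cong (λ t → I t C) (inverseʳ g) ⟩
    I y C                      ∎
    where open ≡-Reasoning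

  perm-injective : ∀ (g : Perm) {y z} → g ⟨$⟩ʳ y ≡ g ⟨$⟩ʳ z → y ≡ z
  perm-injective g {y} {z} gy≡gz = trans (sym (inverseˡ g)) (trans (cong (g ⟨$⟩ˡ_) gy≡gz) (inverseˡ g))

  -- a flag-transitive group is transitive on points (every point is on a block)
  point-transitive : ∀ x y → ∃ λ g → G g × g ⟨$⟩ʳ x ≡ y
  point-transitive x y = proj₁ flag-map , proj₁ (proj₂ flag-map) , proj₁ (proj₂ (proj₂ flag-map))
    where
    flag-map : ∃ λ g → G g × g ⟨$⟩ʳ x ≡ y × MapsBlock I g (proj₁ (block-through x)) (proj₁ (block-through y))
    flag-map = flag-transitive x y _ _ (proj₂ (block-through x)) (proj₂ (block-through y))

  blockImage : ∀ g → G g → Fin v → Fin v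
  blockImage g g∈G B = proj₁ (automorphism g g∈G B)

  blockImage-maps : ∀ g g∈G B → MapsBlock I g B (blockImage g g∈G B)
  blockImage-maps g g∈G B = proj₂ (automorphism g g∈G B)

  blockPerm : ∀ g → G g → Perm
  blockPerm g g∈G = permutation (blockImage g g∈G) (blockImage (flip g) (G-flip g g∈G))
    (λ B → maps-unique g (maps-flip (flip g) (blockImage-maps (flip g) (G-flip g g∈G) B))
                         (blockImage-maps g g∈G _))
    (λ B → maps-unique (flip g) (maps-flip g (blockImage-maps g g∈G B))
                                (blockImage-maps (flip g) (G-flip g g∈G) _))

  -- If G is 2-transitive, G_x is transitive on the blocks missing x; hence G
  -- is flag-transitive on the complementary design.
  module FromTwoTransitive (two-transitive : TwoTransitive G) where

    Mover : Fin v → Fin v → Fin v → Set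
    Mover x y z = Σ Perm λ g → Stabilises x g × (x ≢ y → x ≢ z → g ⟨$⟩ʳ y ≡ z)

    mover : ∀ x y z → Mover x y z
    mover x y z with x ≟ᶠ y | x ≟ᶠ z
    ... | yes x≡y | _       = id , (G-id , refl) , λ x≢y _ → ⊥-elim (x≢y x≡y)
    ... | no _    | yes x≡z = id , (G-id , refl) , λ _ x≢z → ⊥-elim (x≢z x≡z)
    ... | no x≢y  | no x≢z  with two-transitive x y x z x≢y x≢z
    ...   | g , g∈G , gx≡x , gy≡z = g , (g∈G , gx≡x) , λ _ _ → gy≡z

    module AtPoint (x B₀ : Fin v) (x∉B₀ : I x B₀ ≡ false) where

      moverAt : Fin v → Fin v → Perm
      moverAt y z = proj₁ (mover x y z)

      moverAt-∈G : ∀ y z → G (moverAt y z)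
      moverAt-∈G y z = proj₁ (proj₁ (proj₂ (mover x y z)))

      moverAt-stabilises : ∀ y z → Stabilises x (moverAt y z)
      moverAt-stabilises y z = proj₁ (proj₂ (mover x y z))

      π : Fin v → Fin v → Perm
      π y z = blockPerm (moverAt y z) (moverAt-∈G y z)

      open Closure π using (closure; closure-∋-y₀; closure-least; closure-stable)

      Reached : Fin v → Set
      Reached C = ∃ λ g → Stabilises x g × MapsBlock I g B₀ C

      Q : Fin v → Bool
      Q = closure B₀

      Q⊆Reached : ∀ C → Q C ≡ true → Reached C
      Q⊆Reached = closure-least B₀ Reached (id , (G-id , refl) , λ _ → refl) forward backward
        where
        forward : ∀ y z C → Reached C → Reached (π y z ⟨$⟩ʳ C)
        forward y z C (g , g-stab , g-maps) = g ∘ₚ moverAt y z , stabiliser-∘ g-stab (moverAt-stabilises y z) ,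
          maps-∘ g (moverAt y z) g-maps (blockImage-maps (moverAt y z) (moverAt-∈G y z) C)
        backward : ∀ y z C → Reached C → Reached (π y z ⟨$⟩ˡ C)
        backward y z C (g , g-stab , g-maps) = g ∘ₚ flip (moverAt y z) ,
          stabiliser-∘ g-stab (stabiliser-flip (moverAt-stabilises y z)) ,
          maps-∘ g (flip (moverAt y z)) g-maps (blockImage-maps (flip (moverAt y z)) (G-flip _ (moverAt-∈G y z)) C)

      Q-misses-x : ∀ C → Q C ≡ true → I x C ≡ false
      Q-misses-x C C∈Q with Q⊆Reached C C∈Q
      ... | g , (_ , gx≡x) , g-maps = trans (cong (λ y → I y C) (sym gx≡x)) (trans (g-maps x) x∉B₀)

      -- the mover for (y, z) carries the flags of Q at y to those at z
      Q-uniform : ∀ y z → x ≢ y → x ≢ z → degree Q y ≡ degree Q z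
      Q-uniform y z x≢y x≢z = begin
        ∑ (λ C → χ (Q C) * inc y C)                  ≡⟨ ∑-cong moved ⟨
        ∑ (λ C → χ (Q (π y z ⟨$⟩ʳ C)) * inc z (π y z ⟨$⟩ʳ C)) ≡⟨ ∑-permute (λ C → χ (Q C) * inc z C) (π y z) ⟨
        ∑ (λ C → χ (Q C) * inc z C)                  ∎
        where
        open ≡-Reasoning
        h : Perm
        h = moverAt y z
        moved : ∀ C → χ (Q (π y z ⟨$⟩ʳ C)) * inc z (π y z ⟨$⟩ʳ C) ≡ χ (Q C) * inc y C
        moved C = cong₂ (λ p b → χ p * χ b) (closure-stable B₀ y z C) (begin
          I z (π y z ⟨$⟩ʳ C)           ≡⟨ cong (λ t → I t (π y z ⟨$⟩ʳ C)) (proj₂ (proj₂ (mover x y z)) x≢y x≢z) ⟨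
          I (h ⟨$⟩ʳ y) (π y z ⟨$⟩ʳ C)  ≡⟨ blockImage-maps h (moverAt-∈G y z) C y ⟩
          I y C                        ∎)

      reaches-all : ∀ C → I x C ≡ false → Reached C
      reaches-all C x∉C = Q⊆Reached C
        (uniform-block-set x Q Q-misses-x (B₀ , closure-∋-y₀ B₀) Q-uniform C x∉C)

    complement-flag-transitive : FlagTransitive (complement I) G
    complement-flag-transitive x y B C x∉B y∉C =
      g ∘ₚ h , G-∘ g h g∈G h∈G , trans (cong (h ⟨$⟩ʳ_) gx≡y) hy≡y ,
      λ z → cong not (maps-∘ g h (blockImage-maps g g∈G B) h-maps z)
      where
      g-data : ∃ λ g → G g × g ⟨$⟩ʳ x ≡ y
      g-data = point-transitive x y
      g : Perm
      g = proj₁ g-data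
      g∈G : G g
      g∈G = proj₁ (proj₂ g-data)
      gx≡y : g ⟨$⟩ʳ x ≡ y
      gx≡y = proj₂ (proj₂ g-data)
      B′ : Fin v
      B′ = blockImage g g∈G B
      y∉B′ : I y B′ ≡ false
      y∉B′ = trans (cong (λ t → I t B′) (sym gx≡y)) (trans (blockImage-maps g g∈G B x) (Bool.not-injective x∉B))
      h-data : ∃ λ h → Stabilises y h × MapsBlock I h B′ C
      h-data = AtPoint.reaches-all y B′ y∉B′ C (Bool.not-injective y∉C)
      h : Perm
      h = proj₁ h-data
      h∈G : G h
      h∈G = proj₁ (proj₁ (proj₂ h-data))
      hy≡y : h ⟨$⟩ʳ y ≡ y
      hy≡y = proj₂ (proj₁ (proj₂ h-data))
      h-maps : MapsBlock I h B′ C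
      h-maps = proj₂ (proj₂ h-data)

  -- If G is also flag-transitive on the complement, G_x is transitive on the
  -- points other than x; hence G is 2-transitive.
  module FromComplementFlagTransitive (complement-transitive : FlagTransitive (complement I) G) where

    Mover : Fin v → Fin v → Fin v → Set
    Mover x B C = Σ Perm λ g → Stabilises x g × (I x B ≡ I x C → MapsBlock I g B C)

    mover : ∀ x B C → Mover x B C
    mover x B C with I x B in x∈B | I x C in x∈C
    ... | true  | true  with flag-transitive x x B C x∈B x∈C
    ...   | g , g∈G , gx≡x , g-maps = g , (g∈G , gx≡x) , λ _ → g-maps
    mover x B C | false | false with complement-transitive x x B C (cong not x∈B) (cong not x∈C)
    ...   | g , g∈G , gx≡x , g-maps = g , (g∈G , gx≡x) , λ _ z → Bool.not-injective (g-maps z)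
    mover x B C | true  | false = id , (G-id , refl) , λ ()
    mover x B C | false | true  = id , (G-id , refl) , λ ()

    module AtPoint (x y₀ : Fin v) (x≢y₀ : x ≢ y₀) where

      π : Fin v → Fin v → Perm
      π B C = proj₁ (mover x B C)

      π-stabilises : ∀ B C → Stabilises x (π B C)
      π-stabilises B C = proj₁ (proj₂ (mover x B C))

      open Closure π using (closure; closure-∋-y₀; closure-least; closure-stable)

      Reached : Fin v → Set
      Reached z = ∃ λ g → Stabilises x g × g ⟨$⟩ʳ y₀ ≡ z

      O : Fin v → Bool
      O = closure y₀

      O⊆Reached : ∀ z → O z ≡ true → Reached z
      O⊆Reached = closure-least y₀ Reached (id , (G-id , refl) , refl) forward backward
        where
        forward : ∀ B C z → Reached z → Reached (π B C ⟨$⟩ʳ z)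
        forward B C z (g , g-stab , gy₀≡z) =
          g ∘ₚ π B C , stabiliser-∘ g-stab (π-stabilises B C) , cong (π B C ⟨$⟩ʳ_) gy₀≡z
        backward : ∀ B C z → Reached z → Reached (π B C ⟨$⟩ˡ z)
        backward B C z (g , g-stab , gy₀≡z) =
          g ∘ₚ flip (π B C) , stabiliser-∘ g-stab (stabiliser-flip (π-stabilises B C)) , cong (π B C ⟨$⟩ˡ_) gy₀≡z

      x∉O : O x ≡ false
      x∉O with O x in x∈O
      ... | false = refl
      ... | true with O⊆Reached x x∈O
      ...   | g , (_ , gx≡x) , gy₀≡x = ⊥-elim (x≢y₀ (perm-injective g (trans gx≡x (sym gy₀≡x))))

      -- the mover for (B, C) carries |B ∩ O| to |C ∩ O|
      O-uniform : ∀ B C → I x B ≡ I x C → meets O B ≡ meets O C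
      O-uniform B C same = begin
        ∑ (λ y → χ (O y) * inc y B)                   ≡⟨ ∑-cong moved ⟨
        ∑ (λ y → χ (O (π B C ⟨$⟩ʳ y)) * inc (π B C ⟨$⟩ʳ y) C) ≡⟨ ∑-permute (λ y → χ (O y) * inc y C) (π B C) ⟨
        ∑ (λ y → χ (O y) * inc y C)                   ∎
        where
        open ≡-Reasoning
        moved : ∀ y → χ (O (π B C ⟨$⟩ʳ y)) * inc (π B C ⟨$⟩ʳ y) C ≡ χ (O y) * inc y B
        moved y = cong₂ (λ p b → χ p * χ b) (closure-stable y₀ B C y) (proj₂ (proj₂ (mover x B C)) same y)

      reaches-all : ∀ z → x ≢ z → Reached z
      reaches-all z x≢z = O⊆Reached z
        (uniform-point-set x O x∉O (y₀ , closure-∋-y₀ y₀) O-uniform z x≢z)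

    two-transitive : TwoTransitive G
    two-transitive x₁ x₂ y₁ y₂ x₁≢x₂ y₁≢y₂ =
      g ∘ₚ h , G-∘ g h g∈G h∈G , trans (cong (h ⟨$⟩ʳ_) gx₁≡y₁) hy₁≡y₁ , hgx₂≡y₂
      where
      g-data : ∃ λ g → G g × g ⟨$⟩ʳ x₁ ≡ y₁
      g-data = point-transitive x₁ y₁
      g : Perm
      g = proj₁ g-data
      g∈G : G g
      g∈G = proj₁ (proj₂ g-data)
      gx₁≡y₁ : g ⟨$⟩ʳ x₁ ≡ y₁
      gx₁≡y₁ = proj₂ (proj₂ g-data)
      y₁≢gx₂ : y₁ ≢ g ⟨$⟩ʳ x₂
      y₁≢gx₂ y₁≡gx₂ = x₁≢x₂ (perm-injective g (trans gx₁≡y₁ y₁≡gx₂))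
      h-data : ∃ λ h → Stabilises y₁ h × h ⟨$⟩ʳ (g ⟨$⟩ʳ x₂) ≡ y₂
      h-data = AtPoint.reaches-all y₁ (g ⟨$⟩ʳ x₂) y₁≢gx₂ y₂ y₁≢y₂
      h : Perm
      h = proj₁ h-data
      h∈G : G h
      h∈G = proj₁ (proj₁ (proj₂ h-data))
      hy₁≡y₁ : h ⟨$⟩ʳ y₁ ≡ y₁
      hy₁≡y₁ = proj₂ (proj₁ (proj₂ h-data))
      hgx₂≡y₂ : h ⟨$⟩ʳ (g ⟨$⟩ʳ x₂) ≡ y₂
      hgx₂≡y₂ = proj₂ (proj₂ h-data)

  two-transitive⇔complement-flag-transitive : TwoTransitive G ⇔ FlagTransitive (complement I) G
  two-transitive⇔complement-flag-transitive =
    mk⇔ FromTwoTransitive.complement-flag-transitive FromComplementFlagTransitive.two-transitive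

lemma2p4 : (v k λ' : ℕ) (I : Incidence v v) (G : Permutation′ v → Set) →
    IsSymmetricDesign v k λ' I → NonTrivial v k →
    IsAutGroup I G → FlagTransitive I G →
    (TwoTransitive G ⇔ FlagTransitive (complement I) G)
lemma2p4 zero       k          λ' I G design (_ , ())
lemma2p4 (suc w)    zero       λ' I G design (() , _)
lemma2p4 (suc w)    (suc k₁)   λ' I G design (2<k , k+1<v) aut-group flag-transitive =
  FlagTransitiveGroup.two-transitive⇔complement-flag-transitive
    w k₁ λ' I design (≤-pred (≤-trans (n≤1+n 2) 2<k)) (≤-pred (≤-trans (n≤1+n _) k+1<v)) G aut-group flag-transitive
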